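{- Let $\{\overrightarrow{AB},\overrightarrow{AD}\}$ be a proper pair of segments that define a $2$-threshold function $f$ on $\mathcal{G}_{m,n}$. Then $M_1(f)=\{A\}$.
   Context: $\mathcal{G}_{m,n}=\{0,\dots,m-1\}\times\{0,\dots,n-1\}$; $M_1(f)$ is the set of true points of $f$. A $2$-threshold function is a conjunction of at most two threshold functions ($f$ threshold iff $f(x_1,x_2)=1\iff a_1x_1+a_2x_2\ge a_0$ for some $a_0,a_1,a_2$). Two integer points are adjacent if the segment joining them contains no other integer point; such a segment is called prime. For distinct points $A,B,C$ the oriented triangle $\overrightarrow{ABC}$ is counterclockwise if the determinant with rows $(a_1,a_2,1),(b_1,b_2,1),(c_1,c_2,1)$ is positive. For adjacent $A,B\in\mathcal{G}_{m,n}$, $f_{\overrightarrow{AB}}:\mathcal{G}_{m,n}\to\{0,1\}$ has $f(A)=1$, $f(B)=0$; for $X$ on the line $\ell(AB)$, $f(X)=1$ iff $d(A,X)<d(B,X)$; for $X\notin\ell(AB)$, $f(X)=1$ iff $\overrightarrow{ABX}$ is counterclockwise. A pair $\{\overrightarrow{AB},\overrightarrow{CD}\}$ defines $f$ if $f=f_{\overrightarrow{AB}}\wedge f_{\overrightarrow{CD}}$; it is proper if both segments are prime and $f_{\overrightarrow{CD}}(A)=f_{\overrightarrow{CD}}(B)=f_{\overrightarrow{AB}}(C)=f_{\overrightarrow{AB}}(D)=1$. -}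

module Defs where

open import Data.Nat using (ℕ)
open import Data.Bool using (Bool; true; false; if_then_else_; _∧_)
open import Data.Integer using (ℤ; +_; _+_; _-_; _*_; _≤_; _<_)
import Data.Integer as ℤ
open import Data.Fin using (Fin; toℕ)
open import Data.Product using (_×_; _,_; proj₁; proj₂)
open import Data.Sum using (_⊎_)
open import Relation.Binary.PropositionalEquality using (_≡_)
open import Relation.Nullary using (¬_)
open import Relation.Nullary.Decidable using (⌊_⌋)

Pt : Set
Pt = ℤ × ℤ

Grid : ℕ → ℕ → Set
Grid m n = Fin m × Fin n

pt : ∀ {m n} → Grid m n → Pt
pt (i , j) = (+ toℕ i , + toℕ j)

-- Determinant with rows (a1,a2,1),(b1,b2,1),(c1,c2,1)
det : Pt → Pt → Pt → ℤ
det (a1 , a2) (b1 , b2) (c1 , c2) =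
  a1 * (b2 - c2) - a2 * (b1 - c1) + (b1 * c2 - b2 * c1)

CCW : Pt → Pt → Pt → Set
CCW A B C = + 0 < det A B C

OnLine : Pt → Pt → Pt → Set
OnLine A B X = det A B X ≡ + 0

Between : ℤ → ℤ → ℤ → Set
Between a b x = (a ≤ x × x ≤ b) ⊎ (b ≤ x × x ≤ a)

OnSegment : Pt → Pt → Pt → Set
OnSegment A B X =
  OnLine A B X × Between (proj₁ A) (proj₁ B) (proj₁ X)
               × Between (proj₂ A) (proj₂ B) (proj₂ X)

-- A and B are adjacent: distinct, and the segment AB contains no other
-- integer point (the segment AB is then called prime)
Adjacent : Pt → Pt → Set
Adjacent A B = ¬ (A ≡ B) × (∀ (X : Pt) → OnSegment A B X → X ≡ A ⊎ X ≡ B)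

-- squared Euclidean distance (comparing squares = comparing distances)
dist² : Pt → Pt → ℤ
dist² (a1 , a2) (x1 , x2) = (a1 - x1) * (a1 - x1) + (a2 - x2) * (a2 - x2)

fSeg : ∀ {m n} → Grid m n → Grid m n → Grid m n → Bool
fSeg A B X =
  if ⌊ det (pt A) (pt B) (pt X) ℤ.≟ + 0 ⌋
  then ⌊ dist² (pt A) (pt X) ℤ.<? dist² (pt B) (pt X) ⌋
  else ⌊ + 0 ℤ.<? det (pt A) (pt B) (pt X) ⌋

Defines : ∀ {m n} → Grid m n → Grid m n → Grid m n → Grid m n
        → (Grid m n → Bool) → Set
Defines A B C D f = ∀ X → f X ≡ (fSeg A B X ∧ fSeg C D X)

Proper : ∀ {m n} → Grid m n → Grid m n → Grid m n → Grid m n → Set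
Proper A B C D =
  Adjacent (pt A) (pt B) × Adjacent (pt C) (pt D)
  × fSeg C D A ≡ true × fSeg C D B ≡ true
  × fSeg A B C ≡ true × fSeg A B D ≡ true

M₁ : ∀ {m n} → (Grid m n → Bool) → Grid m n → Set
M₁ f X = f X ≡ true

-- Move A to the origin and write u = B − A, w = D − A. The function f_{AB} selects the open
-- half-plane to the left of u together with the points of ℓ(AB) nearer to A than to B. As
-- f_{AB}(D) = f_{AD}(B) = 1, the cross product u × w is both ≥ 0 and ≤ 0, so u and w are
-- collinear, and comparing 2u·w < |u|², |w|² with Lagrange's identity shows that they point in
-- opposite directions. Then the two open half-planes are disjoint and the two conditions
-- on the common line leave only A and lattice points strictly inside the halves of [AB] or [AD]
-- nearer to A, of which there are none because both segments are prime.

module Submission where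

open import Defs
open import Data.Nat using (ℕ; s≤s; z≤n)
open import Data.Bool using (Bool; true; _∧_)
open import Data.Integer
  using (ℤ; +_; +0; +[1+_]; -[1+_]; 0ℤ; _+_; _-_; _*_; -_; _≤_; _<_; +≤+; +<+; -<+;
         nonNegative; positive; negative)
import Data.Integer as ℤ
open import Data.Integer.Properties
  using (≤-refl; ≤-reflexive; ≤-antisym; ≤-total; <⇒≤; <⇒≱; ≮⇒≥; ≤∧≢⇒<; <-cmp; <-irrefl; <-asym;
         i≤i+j; i≤j+i; +-mono-≤; +-mono-<-≤; +-monoˡ-<; +-inverseʳ; +-identityʳ; +-injective; +-0-abelianGroup;
         *-zeroʳ; *-monoˡ-≤-nonNeg; *-cancelˡ-≤-pos; *-cancelˡ-≤-neg; i*j≡0⇒i≡0∨j≡0;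
         neg-cancel-≤; neg-cancel-<; i-j≡0⇒i≡j; i-j≤0⇒i≤j; 0≤i-j⇒j≤i)
open import Algebra.Properties.AbelianGroup +-0-abelianGroup using () renaming (∙-cancelˡ to +-cancelˡ-≡)
open import Data.Integer.Tactic.RingSolver using (solve-∀)
open import Data.Bool.Properties using (∧-conicalˡ; ∧-conicalʳ)
open import Data.Fin.Properties using (toℕ-injective)
open import Data.Product using (_×_; _,_; proj₁; proj₂)
open import Data.Sum using (_⊎_; inj₁; inj₂; [_,_]′)
open import Data.Empty using (⊥)
open import Function.Base using (id)
open import Function.Bundles using (_⇔_; mk⇔)
open import Relation.Nullary using (¬_; yes; no; contradiction)
open import Relation.Binary using (tri<; tri≈; tri>)
open import Relation.Binary.PropositionalEquality
  using (_≡_; _≢_; refl; sym; trans; cong; cong₂; subst; module ≡-Reasoning)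

private variable i j : ℤ

0≤i*i : ∀ i → 0ℤ ≤ i * i
0≤i*i +0         = +≤+ z≤n
0≤i*i +[1+ n ]   = +≤+ z≤n
0≤i*i -[1+ n ]   = +≤+ z≤n

pos*pos⇒pos : 0ℤ < i → 0ℤ < j → 0ℤ < i * j
pos*pos⇒pos (+<+ (s≤s _)) (+<+ (s≤s _)) = +<+ (s≤s z≤n)

neg*neg⇒pos : i < 0ℤ → j < 0ℤ → 0ℤ < i * j
neg*neg⇒pos -<+ -<+ = +<+ (s≤s z≤n)

nonNeg*nonNeg⇒nonNeg : 0ℤ ≤ i → 0ℤ ≤ j → 0ℤ ≤ i * j
nonNeg*nonNeg⇒nonNeg {i} 0≤i 0≤j =
  subst (_≤ i * _) (*-zeroʳ i) (*-monoˡ-≤-nonNeg i {{nonNegative 0≤i}} 0≤j)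

nonNeg*nonPos⇒nonPos : 0ℤ ≤ i → j ≤ 0ℤ → i * j ≤ 0ℤ
nonNeg*nonPos⇒nonPos {i} 0≤i j≤0 =
  subst (i * _ ≤_) (*-zeroʳ i) (*-monoˡ-≤-nonNeg i {{nonNegative 0≤i}} j≤0)

pos*-cancel : 0ℤ < i → 0ℤ ≤ i * j → 0ℤ ≤ j
pos*-cancel {i} {j} 0<i 0≤ij =
  *-cancelˡ-≤-pos 0ℤ j i {{positive 0<i}} (subst (_≤ i * j) (sym (*-zeroʳ i)) 0≤ij)

neg*-cancel : i < 0ℤ → 0ℤ ≤ i * j → j ≤ 0ℤ
neg*-cancel {i} {j} i<0 0≤ij =
  *-cancelˡ-≤-neg i 0ℤ j {{negative i<0}} (subst (_≤ i * j) (sym (*-zeroʳ i)) 0≤ij)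

i+c*j≡i : ∀ {c} → c ≡ 0ℤ → i + c * j ≡ i
i+c*j≡i {i} refl = +-identityʳ i

i-[i+i]≡-i : ∀ i → i - (i + i) ≡ - i
i-[i+i]≡-i = solve-∀

i<j⇒0<j-i : i < j → 0ℤ < j - i
i<j⇒0<j-i {i} {j} i<j = subst (_< j - i) (+-inverseʳ i) (+-monoˡ-< (- i) i<j)

i*i≡0⇒i≡0 : i * i ≡ 0ℤ → i ≡ 0ℤ
i*i≡0⇒i≡0 {i} ii≡0 = [ id , id ]′ (i*j≡0⇒i≡0∨j≡0 i ii≡0)

i*i+j*j≡0⇒i≡0∧j≡0 : ∀ i j → i * i + j * j ≡ 0ℤ → i ≡ 0ℤ × j ≡ 0ℤ
i*i+j*j≡0⇒i≡0∧j≡0 i j sum≡0 =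
  i*i≡0⇒i≡0 (≤-antisym ii≤0 (0≤i*i i)) , i*i≡0⇒i≡0 (≤-antisym jj≤0 (0≤i*i j))
  where
  ii≤0 : i * i ≤ 0ℤ
  ii≤0 = subst (i * i ≤_) sum≡0 (i≤i+j (i * i) (j * j) {{nonNegative (0≤i*i j)}})
  jj≤0 : j * j ≤ 0ℤ
  jj≤0 = subst (j * j ≤_) sum≡0 (i≤j+i (j * j) (i * i) {{nonNegative (0≤i*i i)}})

0≤[y-a]*[b-y]⇒Between : ∀ {a b y} → 0ℤ ≤ (y - a) * (b - y) → Between a b y
0≤[y-a]*[b-y]⇒Between {a} {b} {y} 0≤prod with <-cmp (y - a) 0ℤ
... | tri< y-a<0 _ _ = inj₂ (i-j≤0⇒i≤j (neg*-cancel y-a<0 0≤prod) , i-j≤0⇒i≤j (<⇒≤ y-a<0))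
... | tri> _ _ 0<y-a = inj₁ (0≤i-j⇒j≤i (<⇒≤ 0<y-a) , 0≤i-j⇒j≤i (pos*-cancel 0<y-a 0≤prod))
... | tri≈ _ y-a≡0 _ with i-j≡0⇒i≡j y a y-a≡0 | ≤-total a b
...   | refl | inj₁ a≤b = inj₁ (≤-refl , a≤b)
...   | refl | inj₂ b≤a = inj₂ (b≤a , ≤-refl)

infixl 6 _⊖_
infix  7 _·_

_⊖_ : Pt → Pt → Pt
(a₁ , a₂) ⊖ (b₁ , b₂) = a₁ - b₁ , a₂ - b₂

_·_ : Pt → Pt → ℤ
(u₁ , u₂) · (x₁ , x₂) = u₁ * x₁ + u₂ * x₂

cross : Pt → Pt → ℤ
cross (u₁ , u₂) (x₁ , x₂) = u₁ * x₂ - u₂ * x₁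

∥_∥² : Pt → ℤ
∥ u ∥² = u · u

𝟘 : Pt
𝟘 = 0ℤ , 0ℤ

·-comm : ∀ u w → u · w ≡ w · u
·-comm (u₁ , u₂) (w₁ , w₂) = identity u₁ u₂ w₁ w₂
  where
  identity : ∀ u₁ u₂ w₁ w₂ → u₁ * w₁ + u₂ * w₂ ≡ w₁ * u₁ + w₂ * u₂
  identity = solve-∀

cross-antisym : ∀ u w → cross w u ≡ - cross u w
cross-antisym (u₁ , u₂) (w₁ , w₂) = identity u₁ u₂ w₁ w₂
  where
  identity : ∀ u₁ u₂ w₁ w₂ → w₁ * u₂ - w₂ * u₁ ≡ - (u₁ * w₂ - u₂ * w₁)
  identity = solve-∀

lagrange : ∀ u x → ∥ u ∥² * ∥ x ∥² ≡ (u · x) * (u · x) + cross u x * cross u x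
lagrange (u₁ , u₂) (x₁ , x₂) = identity u₁ u₂ x₁ x₂
  where
  identity : ∀ u₁ u₂ x₁ x₂ →
    (u₁ * u₁ + u₂ * u₂) * (x₁ * x₁ + x₂ * x₂)
      ≡ (u₁ * x₁ + u₂ * x₂) * (u₁ * x₁ + u₂ * x₂) + (u₁ * x₂ - u₂ * x₁) * (u₁ * x₂ - u₂ * x₁)
  identity = solve-∀

cross-expand : ∀ u w x → cross u x * (u · w) ≡ cross w x * ∥ u ∥² + cross u w * (u · x)
cross-expand (u₁ , u₂) (w₁ , w₂) (x₁ , x₂) = identity u₁ u₂ w₁ w₂ x₁ x₂
  where
  identity : ∀ u₁ u₂ w₁ w₂ x₁ x₂ →
    (u₁ * x₂ - u₂ * x₁) * (u₁ * w₁ + u₂ * w₂)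
      ≡ (w₁ * x₂ - w₂ * x₁) * (u₁ * u₁ + u₂ * u₂) + (u₁ * w₂ - u₂ * w₁) * (u₁ * x₁ + u₂ * x₂)
  identity = solve-∀

dot-expand : ∀ u w x → ∥ x ∥² * (u · w) ≡ (u · x) * (w · x) + cross u x * cross w x
dot-expand (u₁ , u₂) (w₁ , w₂) (x₁ , x₂) = identity u₁ u₂ w₁ w₂ x₁ x₂
  where
  identity : ∀ u₁ u₂ w₁ w₂ x₁ x₂ →
    (x₁ * x₁ + x₂ * x₂) * (u₁ * w₁ + u₂ * w₂)
      ≡ (u₁ * x₁ + u₂ * x₂) * (w₁ * x₁ + w₂ * x₂) + (u₁ * x₂ - u₂ * x₁) * (w₁ * x₂ - w₂ * x₁)
  identity = solve-∀

0≤∥u∥² : ∀ u → 0ℤ ≤ ∥ u ∥²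
0≤∥u∥² (u₁ , u₂) = +-mono-≤ (0≤i*i u₁) (0≤i*i u₂)

∥u∥²≡0⇒u≡𝟘 : ∀ u → ∥ u ∥² ≡ 0ℤ → u ≡ 𝟘
∥u∥²≡0⇒u≡𝟘 (u₁ , u₂) ∥u∥²≡0 with i*i+j*j≡0⇒i≡0∧j≡0 u₁ u₂ ∥u∥²≡0
... | refl , refl = refl

u≢𝟘⇒0<∥u∥² : ∀ u → u ≢ 𝟘 → 0ℤ < ∥ u ∥²
u≢𝟘⇒0<∥u∥² u u≢𝟘 = ≤∧≢⇒< (0≤∥u∥² u) (λ 0≡∥u∥² → u≢𝟘 (∥u∥²≡0⇒u≡𝟘 u (sym 0≡∥u∥²)))

-- f_{AB} seen from A, with u = B − A and x = X − A: off the line ℓ(AB) it tests the sign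
-- of u × x, on it d(A,X) < d(B,X) reads 2 u·x < |u|².
InHalfPlane : Pt → Pt → Set
InHalfPlane u x = (cross u x ≡ 0ℤ × 0ℤ < ∥ u ∥² - (u · x + u · x)) ⊎ 0ℤ < cross u x

Opposed : Pt → Pt → Set
Opposed u w = cross u w ≡ 0ℤ × u · w ≤ 0ℤ

-- x = λu with 0 < λ < 1/2.
InNearHalf : Pt → Pt → Set
InNearHalf u x = cross u x ≡ 0ℤ × 0ℤ < u · x × 0ℤ < ∥ u ∥² - (u · x + u · x)

InHalfPlane⇒0≤cross : ∀ u x → InHalfPlane u x → 0ℤ ≤ cross u x
InHalfPlane⇒0≤cross _ _ (inj₁ (u×x≡0 , _)) = ≤-reflexive (sym u×x≡0)
InHalfPlane⇒0≤cross _ _ (inj₂ 0<u×x)      = <⇒≤ 0<u×x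

InHalfPlane-onLine : ∀ u x → InHalfPlane u x → cross u x ≡ 0ℤ → 0ℤ < ∥ u ∥² - (u · x + u · x)
InHalfPlane-onLine _ _ (inj₁ (_ , nearer)) _     = nearer
InHalfPlane-onLine _ _ (inj₂ 0<u×x)        u×x≡0 = contradiction 0<u×x (<-irrefl (sym u×x≡0))

cross≡0-sym : ∀ u w → cross u w ≡ 0ℤ → cross w u ≡ 0ℤ
cross≡0-sym u w u×w≡0 = trans (cross-antisym u w) (cong -_ u×w≡0)

Opposed-sym : ∀ u w → Opposed u w → Opposed w u
Opposed-sym u w (u×w≡0 , u·w≤0) = cross≡0-sym u w u×w≡0 , subst (_≤ 0ℤ) (·-comm u w) u·w≤0

-- If u·w > 0, then 2u·w < |u|² and 2u·w < |w|² give |u|²|w|² > (u·w)², whereas Lagrange's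
-- identity gives equality for collinear u, w.
collinear-nearer⇒dot≤0 : ∀ u w → cross u w ≡ 0ℤ →
  0ℤ < ∥ u ∥² - (u · w + u · w) → 0ℤ < ∥ w ∥² - (u · w + u · w) → u · w ≤ 0ℤ
collinear-nearer⇒dot≤0 u w u×w≡0 0<s 0<t = ≮⇒≥ λ 0<p → <-irrefl (sym excess≡0) (0<excess 0<p)
  where
  open ≡-Reasoning
  p s t : ℤ
  p = u · w
  s = ∥ u ∥² - (p + p)
  t = ∥ w ∥² - (p + p)

  excess : ℤ
  excess = s * t + p * ((s + t) + (s + t)) + (p * p + p * p + p * p)

  expansion : ∀ U W p → let s = U - (p + p); t = W - (p + p) in
    U * W ≡ p * p + (s * t + p * ((s + t) + (s + t)) + (p * p + p * p + p * p))
  expansion = solve-∀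

  0<excess : 0ℤ < p → 0ℤ < excess
  0<excess 0<p = +-mono-<-≤
    (+-mono-<-≤ (pos*pos⇒pos 0<s 0<t)
                (nonNeg*nonNeg⇒nonNeg (<⇒≤ 0<p) (+-mono-≤ 0≤s+t 0≤s+t)))
    (+-mono-≤ (+-mono-≤ (0≤i*i p) (0≤i*i p)) (0≤i*i p))
    where
    0≤s+t : 0ℤ ≤ s + t
    0≤s+t = +-mono-≤ (<⇒≤ 0<s) (<⇒≤ 0<t)

  excess≡0 : excess ≡ 0ℤ
  excess≡0 = +-cancelˡ-≡ (p * p) excess 0ℤ (begin
    p * p + excess                                ≡⟨ expansion ∥ u ∥² ∥ w ∥² p ⟨
    ∥ u ∥² * ∥ w ∥²                               ≡⟨ lagrange u w ⟩
    p * p + cross u w * cross u w                 ≡⟨ cong (λ c → p * p + c * c) u×w≡0 ⟩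
    p * p + 0ℤ                                    ∎)

mutual-halfPlanes⇒Opposed : ∀ u w → InHalfPlane u w → InHalfPlane w u → Opposed u w
mutual-halfPlanes⇒Opposed u w u⊢w w⊢u =
  u×w≡0 , collinear-nearer⇒dot≤0 u w u×w≡0 (InHalfPlane-onLine u w u⊢w u×w≡0) w-nearer
  where
  u×w≡0 : cross u w ≡ 0ℤ
  u×w≡0 = ≤-antisym (neg-cancel-≤ (subst (0ℤ ≤_) (cross-antisym u w) (InHalfPlane⇒0≤cross w u w⊢u)))
                    (InHalfPlane⇒0≤cross u w u⊢w)
  w-nearer : 0ℤ < ∥ w ∥² - (u · w + u · w)
  w-nearer = subst (λ q → 0ℤ < ∥ w ∥² - (q + q)) (·-comm w u)
                   (InHalfPlane-onLine w u w⊢u (cross≡0-sym u w u×w≡0))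

Opposed⇒cross≤0 : ∀ u w x → Opposed u w → 0ℤ < ∥ u ∥² → 0ℤ ≤ cross u x → cross w x ≤ 0ℤ
Opposed⇒cross≤0 u w x (u×w≡0 , u·w≤0) 0<∥u∥² 0≤u×x = ≮⇒≥ λ 0<w×x →
  <⇒≱ (pos*pos⇒pos 0<w×x 0<∥u∥²)
      (subst (_≤ 0ℤ) u×x*u·w≡w×x*∥u∥² (nonNeg*nonPos⇒nonPos 0≤u×x u·w≤0))
  where
  u×x*u·w≡w×x*∥u∥² : cross u x * (u · w) ≡ cross w x * ∥ u ∥²
  u×x*u·w≡w×x*∥u∥² = trans (cross-expand u w x) (i+c*j≡i u×w≡0)

Opposed⇒halfPlanes-meet-on-line : ∀ u w x → Opposed u w → 0ℤ < ∥ u ∥² → 0ℤ < ∥ w ∥² →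
  InHalfPlane u x → InHalfPlane w x → cross u x ≡ 0ℤ × cross w x ≡ 0ℤ
Opposed⇒halfPlanes-meet-on-line u w x u⇅w 0<∥u∥² 0<∥w∥² u⊢x w⊢x =
  ≤-antisym (Opposed⇒cross≤0 w u x (Opposed-sym u w u⇅w) 0<∥w∥² 0≤w×x) 0≤u×x ,
  ≤-antisym (Opposed⇒cross≤0 u w x u⇅w 0<∥u∥² 0≤u×x) 0≤w×x
  where
  0≤u×x : 0ℤ ≤ cross u x
  0≤u×x = InHalfPlane⇒0≤cross u x u⊢x
  0≤w×x : 0ℤ ≤ cross w x
  0≤w×x = InHalfPlane⇒0≤cross w x w⊢x

collinear∧orthogonal⇒𝟘 : ∀ u x → 0ℤ < ∥ u ∥² → cross u x ≡ 0ℤ → u · x ≡ 0ℤ → x ≡ 𝟘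
collinear∧orthogonal⇒𝟘 u x 0<∥u∥² u×x≡0 u·x≡0 =
  [ (λ ∥u∥²≡0 → contradiction 0<∥u∥² (<-irrefl (sym ∥u∥²≡0))) , ∥u∥²≡0⇒u≡𝟘 x ]′
    (i*j≡0⇒i≡0∨j≡0 ∥ u ∥² ∥u∥²*∥x∥²≡0)
  where
  ∥u∥²*∥x∥²≡0 : ∥ u ∥² * ∥ x ∥² ≡ 0ℤ
  ∥u∥²*∥x∥²≡0 = trans (lagrange u x) (cong₂ (λ d c → d * d + c * c) u·x≡0 u×x≡0)

Opposed⇒¬both-dots-neg : ∀ u w x → Opposed u w → cross u x ≡ 0ℤ → u · x < 0ℤ → w · x < 0ℤ → ⊥
Opposed⇒¬both-dots-neg u w x (_ , u·w≤0) u×x≡0 u·x<0 w·x<0 =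
  <⇒≱ (neg*neg⇒pos u·x<0 w·x<0)
      (subst (_≤ 0ℤ) ∥x∥²*u·w≡u·x*w·x (nonNeg*nonPos⇒nonPos (0≤∥u∥² x) u·w≤0))
  where
  ∥x∥²*u·w≡u·x*w·x : ∥ x ∥² * (u · w) ≡ (u · x) * (w · x)
  ∥x∥²*u·w≡u·x*w·x = trans (dot-expand u w x) (i+c*j≡i u×x≡0)

Opposed⇒collinear-cases : ∀ u w x → Opposed u w → 0ℤ < ∥ u ∥² → 0ℤ < ∥ w ∥² →
  cross u x ≡ 0ℤ → cross w x ≡ 0ℤ →
  0ℤ < ∥ u ∥² - (u · x + u · x) → 0ℤ < ∥ w ∥² - (w · x + w · x) →
  x ≡ 𝟘 ⊎ (InNearHalf u x ⊎ InNearHalf w x)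
Opposed⇒collinear-cases u w x u⇅w 0<∥u∥² 0<∥w∥² u×x≡0 w×x≡0 u-nearer w-nearer
  with <-cmp (u · x) 0ℤ | <-cmp (w · x) 0ℤ
... | tri> _ _ 0<u·x | _ = inj₂ (inj₁ (u×x≡0 , 0<u·x , u-nearer))
... | _ | tri> _ _ 0<w·x = inj₂ (inj₂ (w×x≡0 , 0<w·x , w-nearer))
... | tri≈ _ u·x≡0 _ | _ = inj₁ (collinear∧orthogonal⇒𝟘 u x 0<∥u∥² u×x≡0 u·x≡0)
... | _ | tri≈ _ w·x≡0 _ = inj₁ (collinear∧orthogonal⇒𝟘 w x 0<∥w∥² w×x≡0 w·x≡0)
... | tri< u·x<0 _ _ | tri< w·x<0 _ _ =
  contradiction w·x<0 (Opposed⇒¬both-dots-neg u w x u⇅w u×x≡0 u·x<0)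

mutual-halfPlanes⇒meet-near-origin : ∀ u w x → 0ℤ < ∥ u ∥² → 0ℤ < ∥ w ∥² →
  InHalfPlane u w → InHalfPlane w u → InHalfPlane u x → InHalfPlane w x →
  x ≡ 𝟘 ⊎ (InNearHalf u x ⊎ InNearHalf w x)
mutual-halfPlanes⇒meet-near-origin u w x 0<∥u∥² 0<∥w∥² u⊢w w⊢u u⊢x w⊢x =
  Opposed⇒collinear-cases u w x u⇅w 0<∥u∥² 0<∥w∥² u×x≡0 w×x≡0
    (InHalfPlane-onLine u x u⊢x u×x≡0) (InHalfPlane-onLine w x w⊢x w×x≡0)
  where
  u⇅w : Opposed u w
  u⇅w = mutual-halfPlanes⇒Opposed u w u⊢w w⊢u
  on-line : cross u x ≡ 0ℤ × cross w x ≡ 0ℤ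
  on-line = Opposed⇒halfPlanes-meet-on-line u w x u⇅w 0<∥u∥² 0<∥w∥² u⊢x w⊢x
  u×x≡0 : cross u x ≡ 0ℤ
  u×x≡0 = proj₁ on-line
  w×x≡0 : cross w x ≡ 0ℤ
  w×x≡0 = proj₂ on-line

InNearHalf⇒between : ∀ u x → InNearHalf u x →
  0ℤ ≤ proj₁ x * proj₁ (u ⊖ x) × 0ℤ ≤ proj₂ x * proj₂ (u ⊖ x)
InNearHalf⇒between (u₁ , u₂) (x₁ , x₂) (u×x≡0 , 0<q , 0<s) =
  pos*-cancel 0<q (subst (0ℤ ≤_) (sym first) (nonNeg*nonNeg⇒nonNeg (0≤i*i x₁) 0≤s+q)) ,
  pos*-cancel 0<q (subst (0ℤ ≤_) second (nonNeg*nonNeg⇒nonNeg (0≤i*i x₂) 0≤s+q))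
  where
  q s : ℤ
  q = u₁ * x₁ + u₂ * x₂
  s = u₁ * u₁ + u₂ * u₂ - (q + q)

  0≤s+q : 0ℤ ≤ s + q
  0≤s+q = +-mono-≤ (<⇒≤ 0<s) (<⇒≤ 0<q)

  identity₁ : ∀ u₁ u₂ x₁ x₂ → let q = u₁ * x₁ + u₂ * x₂; s = u₁ * u₁ + u₂ * u₂ - (q + q) in
    q * (x₁ * (u₁ - x₁)) ≡ x₁ * x₁ * (s + q) + (u₁ * x₂ - u₂ * x₁) * (u₂ * x₁)
  identity₁ = solve-∀

  identity₂ : ∀ u₁ u₂ x₁ x₂ → let q = u₁ * x₁ + u₂ * x₂; s = u₁ * u₁ + u₂ * u₂ - (q + q) in
    x₂ * x₂ * (s + q) ≡ q * (x₂ * (u₂ - x₂)) + (u₁ * x₂ - u₂ * x₁) * (u₁ * x₂)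
  identity₂ = solve-∀

  first : q * (x₁ * (u₁ - x₁)) ≡ x₁ * x₁ * (s + q)
  first = trans (identity₁ u₁ u₂ x₁ x₂) (i+c*j≡i u×x≡0)

  second : x₂ * x₂ * (s + q) ≡ q * (x₂ * (u₂ - x₂))
  second = trans (identity₂ u₁ u₂ x₁ x₂) (i+c*j≡i u×x≡0)

⊖-self : ∀ A → A ⊖ A ≡ 𝟘
⊖-self (a₁ , a₂) = cong₂ _,_ (+-inverseʳ a₁) (+-inverseʳ a₂)

⊖≡𝟘⇒≡ : ∀ A B → A ⊖ B ≡ 𝟘 → A ≡ B
⊖≡𝟘⇒≡ (a₁ , a₂) (b₁ , b₂) A⊖B≡𝟘 =
  cong₂ _,_ (i-j≡0⇒i≡j a₁ b₁ (cong proj₁ A⊖B≡𝟘)) (i-j≡0⇒i≡j a₂ b₂ (cong proj₂ A⊖B≡𝟘))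

⊖-cancelʳ : ∀ A B X → (B ⊖ A) ⊖ (X ⊖ A) ≡ B ⊖ X
⊖-cancelʳ (a₁ , a₂) (b₁ , b₂) (x₁ , x₂) = cong₂ _,_ (identity a₁ b₁ x₁) (identity a₂ b₂ x₂)
  where
  identity : ∀ a b x → b - a - (x - a) ≡ b - x
  identity = solve-∀

·-zeroʳ : ∀ u → u · 𝟘 ≡ 0ℤ
·-zeroʳ (u₁ , u₂) = cong₂ _+_ (*-zeroʳ u₁) (*-zeroʳ u₂)

cross-zeroʳ : ∀ u → cross u 𝟘 ≡ 0ℤ
cross-zeroʳ (u₁ , u₂) = cong₂ _-_ (*-zeroʳ u₁) (*-zeroʳ u₂)

distinct⇒0<∥⊖∥² : ∀ A B → A ≢ B → 0ℤ < ∥ B ⊖ A ∥²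
distinct⇒0<∥⊖∥² A B A≢B = u≢𝟘⇒0<∥u∥² (B ⊖ A) (λ B⊖A≡𝟘 → A≢B (sym (⊖≡𝟘⇒≡ B A B⊖A≡𝟘)))

det≡cross : ∀ A B X → det A B X ≡ cross (B ⊖ A) (X ⊖ A)
det≡cross (a₁ , a₂) (b₁ , b₂) (x₁ , x₂) = identity a₁ a₂ b₁ b₂ x₁ x₂
  where
  identity : ∀ a₁ a₂ b₁ b₂ x₁ x₂ →
    a₁ * (b₂ - x₂) - a₂ * (b₁ - x₁) + (b₁ * x₂ - b₂ * x₁)
      ≡ (b₁ - a₁) * (x₂ - a₂) - (b₂ - a₂) * (x₁ - a₁)
  identity = solve-∀

dist²-difference : ∀ A B X →
  dist² B X - dist² A X ≡ ∥ B ⊖ A ∥² - ((B ⊖ A) · (X ⊖ A) + (B ⊖ A) · (X ⊖ A))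
dist²-difference (a₁ , a₂) (b₁ , b₂) (x₁ , x₂) = identity a₁ a₂ b₁ b₂ x₁ x₂
  where
  identity : ∀ a₁ a₂ b₁ b₂ x₁ x₂ → let q = (b₁ - a₁) * (x₁ - a₁) + (b₂ - a₂) * (x₂ - a₂) in
    (b₁ - x₁) * (b₁ - x₁) + (b₂ - x₂) * (b₂ - x₂) - ((a₁ - x₁) * (a₁ - x₁) + (a₂ - x₂) * (a₂ - x₂))
      ≡ (b₁ - a₁) * (b₁ - a₁) + (b₂ - a₂) * (b₂ - a₂) - (q + q)
  identity = solve-∀

-- The only lattice points of a prime segment [AB] are A and B, and neither lies strictly
-- inside the half nearer to A.
prime⇒¬InNearHalf : ∀ A B X → Adjacent A B → ¬ InNearHalf (B ⊖ A) (X ⊖ A)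
prime⇒¬InNearHalf A B X (A≢B , prime) near@(u×x≡0 , 0<q , 0<s) =
  [ X≢A , X≢B ]′ (prime X (onLine , 0≤[y-a]*[b-y]⇒Between between₁ , 0≤[y-a]*[b-y]⇒Between between₂))
  where
  u : Pt
  u = B ⊖ A

  onLine : OnLine A B X
  onLine = trans (det≡cross A B X) u×x≡0

  between : 0ℤ ≤ proj₁ (X ⊖ A) * proj₁ (B ⊖ X) × 0ℤ ≤ proj₂ (X ⊖ A) * proj₂ (B ⊖ X)
  between = subst (λ v → 0ℤ ≤ proj₁ (X ⊖ A) * proj₁ v × 0ℤ ≤ proj₂ (X ⊖ A) * proj₂ v)
                  (⊖-cancelʳ A B X) (InNearHalf⇒between u (X ⊖ A) near)
  between₁ : 0ℤ ≤ proj₁ (X ⊖ A) * proj₁ (B ⊖ X)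
  between₁ = proj₁ between
  between₂ : 0ℤ ≤ proj₂ (X ⊖ A) * proj₂ (B ⊖ X)
  between₂ = proj₂ between

  X≢A : X ≢ A
  X≢A X≡A = <-irrefl (sym u·x≡0) 0<q
    where
    u·x≡0 : u · (X ⊖ A) ≡ 0ℤ
    u·x≡0 = trans (cong (λ Y → u · (Y ⊖ A)) X≡A) (trans (cong (u ·_) (⊖-self A)) (·-zeroʳ u))

  X≢B : X ≢ B
  X≢B X≡B = <-asym (distinct⇒0<∥⊖∥² A B A≢B) (neg-cancel-< (subst (0ℤ <_) U-2U≡-U 0<s))
    where
    U-2U≡-U : ∥ u ∥² - (u · (X ⊖ A) + u · (X ⊖ A)) ≡ - ∥ u ∥²
    U-2U≡-U = trans (cong (λ Y → ∥ u ∥² - (u · (Y ⊖ A) + u · (Y ⊖ A))) X≡B) (i-[i+i]≡-i ∥ u ∥²)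

halfPlanes-meet-at-apex : ∀ A B D X → Adjacent A B → Adjacent A D →
  InHalfPlane (B ⊖ A) (D ⊖ A) → InHalfPlane (D ⊖ A) (B ⊖ A) →
  InHalfPlane (B ⊖ A) (X ⊖ A) → InHalfPlane (D ⊖ A) (X ⊖ A) → X ≡ A
halfPlanes-meet-at-apex A B D X AB-prime AD-prime D∈AB B∈AD X∈AB X∈AD =
  [ ⊖≡𝟘⇒≡ X A
  , [ (λ near-B → contradiction near-B (prime⇒¬InNearHalf A B X AB-prime))
    , (λ near-D → contradiction near-D (prime⇒¬InNearHalf A D X AD-prime)) ]′ ]′
  (mutual-halfPlanes⇒meet-near-origin (B ⊖ A) (D ⊖ A) (X ⊖ A)
     (distinct⇒0<∥⊖∥² A B (proj₁ AB-prime)) (distinct⇒0<∥⊖∥² A D (proj₁ AD-prime))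
     D∈AB B∈AD X∈AB X∈AD)

fSeg⇒InHalfPlane : ∀ {m n} (P Q Y : Grid m n) → fSeg P Q Y ≡ true →
  InHalfPlane (pt Q ⊖ pt P) (pt Y ⊖ pt P)
fSeg⇒InHalfPlane P Q Y fPQY
  with det (pt P) (pt Q) (pt Y) ℤ.≟ + 0
     | dist² (pt P) (pt Y) ℤ.<? dist² (pt Q) (pt Y)
     | + 0 ℤ.<? det (pt P) (pt Q) (pt Y)
... | yes onLine | yes nearer | _ =
  inj₁ (trans (sym (det≡cross (pt P) (pt Q) (pt Y))) onLine ,
        subst (0ℤ <_) (dist²-difference (pt P) (pt Q) (pt Y)) (i<j⇒0<j-i nearer))
... | no _ | _ | yes left = inj₂ (subst (0ℤ <_) (det≡cross (pt P) (pt Q) (pt Y)) left)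
fSeg⇒InHalfPlane P Q Y () | yes _ | no _ | _
fSeg⇒InHalfPlane P Q Y () | no _  | _    | no _

fSeg-apex : ∀ {m n} (P Q : Grid m n) → pt P ≢ pt Q → fSeg P Q P ≡ true
fSeg-apex P Q P≢Q
  with det (pt P) (pt Q) (pt P) ℤ.≟ + 0 | dist² (pt P) (pt P) ℤ.<? dist² (pt Q) (pt P)
... | yes _ | yes _        = refl
... | yes _ | no ¬nearer   = contradiction nearer ¬nearer
  where
  nearer : dist² (pt P) (pt P) < dist² (pt Q) (pt P)
  nearer = subst (_< dist² (pt Q) (pt P)) (sym (cong ∥_∥² (⊖-self (pt P))))
                 (distinct⇒0<∥⊖∥² (pt P) (pt Q) P≢Q)
... | no ¬onLine | _       = contradiction onLine ¬onLine
  where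
  onLine : OnLine (pt P) (pt Q) (pt P)
  onLine = trans (det≡cross (pt P) (pt Q) (pt P))
                 (trans (cong (cross (pt Q ⊖ pt P)) (⊖-self (pt P))) (cross-zeroʳ (pt Q ⊖ pt P)))

pt-injective : ∀ {m n} (X Y : Grid m n) → pt X ≡ pt Y → X ≡ Y
pt-injective (i , j) (k , l) ptX≡ptY =
  cong₂ _,_ (toℕ-injective (+-injective (cong proj₁ ptX≡ptY)))
            (toℕ-injective (+-injective (cong proj₂ ptX≡ptY)))

corollary4 : (m n : ℕ) (A B D : Grid m n) (f : Grid m n → Bool)
    → Proper A B A D → Defines A B A D f
    → (∀ X → M₁ f X ⇔ X ≡ A)
corollary4 m n A B D f (AB-prime , AD-prime , _ , fAD-B , _ , fAB-D) defines X =
  mk⇔ only-apex apex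
  where
  only-apex : M₁ f X → X ≡ A
  only-apex fX = pt-injective X A
    (halfPlanes-meet-at-apex (pt A) (pt B) (pt D) (pt X) AB-prime AD-prime
      (fSeg⇒InHalfPlane A B D fAB-D) (fSeg⇒InHalfPlane A D B fAD-B)
      (fSeg⇒InHalfPlane A B X fAB-X) (fSeg⇒InHalfPlane A D X fAD-X))
    where
    both : fSeg A B X ∧ fSeg A D X ≡ true
    both = trans (sym (defines X)) fX
    fAB-X : fSeg A B X ≡ true
    fAB-X = ∧-conicalˡ (fSeg A B X) (fSeg A D X) both
    fAD-X : fSeg A D X ≡ true
    fAD-X = ∧-conicalʳ (fSeg A B X) (fSeg A D X) both

  apex : X ≡ A → M₁ f X
  apex refl = trans (defines A)
    (cong₂ _∧_ (fSeg-apex A B (proj₁ AB-prime)) (fSeg-apex A D (proj₁ AD-prime)))
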